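{- If $S$ is a complete group (trivial centre and every automorphism inner) that is not perfect, then $S$ is not a chirality group.
   Context: Let $\Delta=\langle r_0,r_1,r_2\mid r_0^2=r_1^2=r_2^2=1\rangle$ and let $\Delta^+$ be its index-$2$ subgroup of even-length words, generated by $\rho=r_1r_2$ and $\lambda=r_2r_0$. An (oriented) hypermap is a triple $(D,R,L)$ with $D$ a finite set and $R,L$ permutations of $D$ generating a group transitive on $D$. It is orientably regular if its automorphism group (permutations of $D$ commuting with $R$ and $L$) acts regularly on $D$; orientably regular hypermaps correspond (up to isomorphism) bijectively to normal subgroups $H$ of finite index in $\Delta^+$ (hypermap subgroups), the hypermap being $(\Delta^+/H,\rho,\lambda)$ acting by left multiplication. For $H\trianglelefteq\Delta^+$ put $H^r=r_2Hr_2$. The chirality group of the hypermap is $HH^r/H$ (isomorphic to $H/(H\cap H^r)$). A group is called a chirality group if it is isomorphic to the chirality group of some orientably regular hypermap. A group is perfect if it has no nontrivial abelian quotient. -}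

module Defs where

open import Level using (Level; _⊔_) renaming (suc to lsuc; zero to lzero)
open import Data.Nat using (ℕ; _%_)
open import Data.Fin using (Fin; zero; suc; _≟_)
open import Data.List using (List; []; _∷_; _++_; reverse; length; [_])
open import Data.List.Membership.Propositional using (_∈_)
open import Data.Product using (Σ; ∃; _×_; _,_)
open import Relation.Nullary using (¬_; yes; no)
open import Relation.Binary.PropositionalEquality using (_≡_)
open import Algebra.Bundles using (Group; AbelianGroup)
open import Algebra.Morphism.Structures using (module GroupMorphisms)
open import Function.Definitions using (Surjective)

-- The extended triangle group Δ = ⟨r₀,r₁,r₂ | r₀²=r₁²=r₂²=1⟩ = C₂*C₂*C₂.
-- Elements are represented by words in the generators (Fin 3, the letter
-- i standing for r_i); two words represent the same element of Δ iff they
-- have the same free-product normal form, obtained by repeatedly cancelling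
-- adjacent equal letters.

Word : Set
Word = List (Fin 3)

push : Fin 3 → Word → Word
push x []       = x ∷ []
push x (y ∷ w) with x ≟ y
... | yes _ = w
... | no  _ = x ∷ y ∷ w

reduce : Word → Word
reduce []      = []
reduce (x ∷ w) = push x (reduce w)

_~_ : Word → Word → Set
u ~ v = reduce u ≡ reduce v

-- group operations of Δ: product = concatenation, identity = empty word,
-- inverse = reversal (each generator is an involution)
_·_ : Word → Word → Word
u · v = u ++ v

inv : Word → Word
inv = reverse

r₂ : Word
r₂ = [ suc (suc zero) ]

InΔ⁺ : Word → Set
InΔ⁺ w = length w % 2 ≡ 0

-- Hypermap subgroups: normal subgroups of finite index in Δ⁺.
-- A subgroup is given as a predicate on words respecting equality in Δ.

record HypermapSubgroup : Set₁ where
  field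
    H        : Word → Set
    respects : ∀ {u v} → u ~ v → H u → H v
    ⊆Δ⁺      : ∀ {w} → H w → InΔ⁺ w
    has-ε    : H []
    ·-closed : ∀ {u v} → H u → H v → H (u · v)
    inv-closed : ∀ {u} → H u → H (inv u)
    normal   : ∀ {g h} → InΔ⁺ g → H h → H (g · (h · inv g))
    -- finite index in Δ⁺: finitely many cosets gH (g ∈ Δ⁺) cover Δ⁺
    finiteIndex : Σ (List Word) λ reps →
                    (∀ {r} → r ∈ reps → InΔ⁺ r) ×
                    (∀ g → InΔ⁺ g → Σ Word λ r → r ∈ reps × H (inv r · g))

  Hʳ : Word → Set
  Hʳ w = H (r₂ · (w · r₂))

-- "S is isomorphic to the chirality group of the hypermap with hypermap
-- subgroup H", using the description H/(H ∩ H^r) of the chirality group.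
-- An isomorphism H/(H∩Hʳ) → S is spelled out on representatives: a map
-- φ from H to S that is a homomorphism, surjective, and whose kernel
-- (i.e. the relation φ h ≈ φ h') is exactly congruence modulo H ∩ Hʳ.

module _ {c ℓ : Level} (S : Group c ℓ) where
  open Group S

  IsoToChiralityGroup : HypermapSubgroup → Set (c ⊔ ℓ)
  IsoToChiralityGroup 𝓗 =
    Σ ((w : Word) → H w → Carrier) λ φ →
      (∀ u v (p : H u) (q : H v) →
         φ (u · v) (·-closed p q) ≈ (φ u p ∙ φ v q)) ×
      (∀ u v (p : H u) (q : H v) →
         (φ u p ≈ φ v q → H (u · inv v) × Hʳ (u · inv v)) ×
         (H (u · inv v) × Hʳ (u · inv v) → φ u p ≈ φ v q)) ×
      (∀ (s : Carrier) → Σ Word λ w → Σ (H w) λ p → φ w p ≈ s)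
    where open HypermapSubgroup 𝓗

  IsChiralityGroup : Set (lsuc lzero ⊔ c ⊔ ℓ)
  IsChiralityGroup = Σ HypermapSubgroup IsoToChiralityGroup

  TrivialCentre : Set (c ⊔ ℓ)
  TrivialCentre = ∀ z → (∀ g → (z ∙ g) ≈ (g ∙ z)) → z ≈ ε

  open GroupMorphisms rawGroup rawGroup

  AllAutomorphismsInner : Set (c ⊔ ℓ)
  AllAutomorphismsInner =
    ∀ (f : Carrier → Carrier) → IsGroupIsomorphism f →
      Σ Carrier λ g → ∀ x → f x ≈ ((g ∙ x) ∙ (g ⁻¹))

  IsComplete : Set (c ⊔ ℓ)
  IsComplete = TrivialCentre × AllAutomorphismsInner

  -- perfect: no nontrivial abelian quotient, i.e. every surjective
  -- homomorphism onto an abelian group has trivial image.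
  IsPerfect : Set (lsuc (c ⊔ ℓ))
  IsPerfect =
    ∀ (A : AbelianGroup c (c ⊔ ℓ)) (f : Carrier → AbelianGroup.Carrier A) →
      GroupMorphisms.IsGroupHomomorphism rawGroup (AbelianGroup.rawGroup A) f →
      Surjective _≈_ (AbelianGroup._≈_ A) f →
      ∀ a → AbelianGroup._≈_ A a (AbelianGroup.ε A)

module Submission where

-- Let K = H ∩ Hʳ, so that S ≅ H/K, where H, Hʳ and K are normal in Δ⁺. Conjugation by
-- g ∈ Δ⁺ preserves H and K, so it induces an automorphism of H/K ≅ S, which by completeness
-- is conjugation by a unique s(g) ∈ S. Uniqueness makes s : Δ⁺ → S a homomorphism; it
-- extends H → H/K and is trivial on Hʳ, because Hʳ centralises H modulo K.
-- Now let f : S → A be a homomorphism into an abelian group and ψ = f ∘ s. Since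
-- a b w = (a r₂)(r₂ b) w with r₂ a = (a r₂)⁻¹, one gets ψ(r₂ w r₂) = ψ(w)⁻¹ on Δ⁺. For w ∈ H
-- we have r₂ w r₂ ∈ Hʳ, hence ψ(w) = 1; as H maps onto S, f is trivial, so S is perfect.

open import Defs
open import Level using (Level; 0ℓ; _⊔_)
open import Data.Nat using (suc; _+_; _%_)
open import Data.Nat.Properties using (+-comm)
open import Data.Nat.DivMod using (%-distribˡ-+)
open import Data.Fin using (Fin; zero; suc; _≟_)
open import Data.List using ([]; _∷_; _++_; reverse; length; foldr)
open import Data.List.Properties using (++-assoc; ++-identityʳ; reverse-involutive; unfold-reverse; length-++; length-reverse)
open import Data.Product using (Σ; _×_; _,_; proj₁; proj₂)
import Data.Product as Product
open import Data.Unit using (⊤)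
open import Data.Empty using (⊥-elim)
open import Relation.Nullary using (¬_; yes; no)
open import Relation.Binary.PropositionalEquality as ≡ using (_≡_; refl; cong; cong₂)
open import Algebra.Bundles using (Group; AbelianGroup; RawGroup)
open import Algebra.Morphism.Structures using (IsGroupMonomorphism; IsGroupHomomorphism; IsGroupIsomorphism; IsMagmaHomomorphism)
open import Function.Definitions using (StrictlySurjective)
open import Function.Consequences using (strictlySurjective⇒surjective)
import Algebra.Morphism.GroupMonomorphism as GroupMonomorphism
import Algebra.Properties.Group as GroupProperties
import Algebra.Properties.AbelianGroup as AbelianGroupProperties
import Algebra.Morphism.Construct.Composition as Composition
import Relation.Binary.Reasoning.Setoid as SetoidReasoning

-- Free reduction of words

pushAll : Word → Word → Word
pushAll u r = foldr push r u

reduce-++ : ∀ u v → reduce (u ++ v) ≡ pushAll u (reduce v)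
reduce-++ []      v = refl
reduce-++ (x ∷ u) v = cong (push x) (reduce-++ u v)

Reduced : Word → Set
Reduced []          = ⊤
Reduced (x ∷ [])    = ⊤
Reduced (x ∷ y ∷ w) = ¬ x ≡ y × Reduced (y ∷ w)

Reduced-tail : ∀ {x w} → Reduced (x ∷ w) → Reduced w
Reduced-tail {w = []}    _       = _
Reduced-tail {w = _ ∷ _} (_ , r) = r

push-Reduced : ∀ x {w} → Reduced w → Reduced (push x w)
push-Reduced x {[]}    _ = _
push-Reduced x {y ∷ w} r with x ≟ y
... | yes _  = Reduced-tail r
... | no x≢y = x≢y , r

pushAll-Reduced : ∀ u {r} → Reduced r → Reduced (pushAll u r)
pushAll-Reduced []      r = r
pushAll-Reduced (x ∷ u) r = push-Reduced x (pushAll-Reduced u r)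

reduce-Reduced : ∀ w → Reduced (reduce w)
reduce-Reduced []      = _
reduce-Reduced (x ∷ w) = push-Reduced x (reduce-Reduced w)

push-cancel : ∀ x w → push x (x ∷ w) ≡ w
push-cancel x w with x ≟ x
... | yes _  = refl
... | no x≢x = ⊥-elim (x≢x refl)

push-involutive : ∀ x {w} → Reduced w → push x (push x w) ≡ w
push-involutive x {[]} _ = push-cancel x []
push-involutive x {y ∷ w} r with x ≟ y
push-involutive x {y ∷ []}    _       | yes refl = refl
push-involutive x {y ∷ z ∷ w} (y≢z , _) | yes refl with x ≟ z
... | yes refl = ⊥-elim (y≢z refl)
... | no _     = refl
push-involutive x {y ∷ w} _ | no _ = push-cancel x (y ∷ w)

pushAll-push : ∀ x {w r} → Reduced w → Reduced r → pushAll (push x w) r ≡ push x (pushAll w r)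
pushAll-push x {[]}    _ _ = refl
pushAll-push x {y ∷ w} _ r with x ≟ y
... | yes refl = ≡.sym (push-involutive x (pushAll-Reduced w r))
... | no _     = refl

pushAll-reduce : ∀ u {r} → Reduced r → pushAll u r ≡ pushAll (reduce u) r
pushAll-reduce []      _ = refl
pushAll-reduce (x ∷ u) r = ≡.trans (cong (push x) (pushAll-reduce u r))
                                   (≡.sym (pushAll-push x (reduce-Reduced u) r))

·-cong : ∀ {u u′ v v′} → u ~ u′ → v ~ v′ → (u · v) ~ (u′ · v′)
·-cong {u} {u′} {v} {v′} u~u′ v~v′ = begin
  reduce (u ++ v)                ≡⟨ reduce-++ u v ⟩
  pushAll u (reduce v)           ≡⟨ pushAll-reduce u (reduce-Reduced v) ⟩
  pushAll (reduce u) (reduce v)  ≡⟨ cong₂ pushAll u~u′ v~v′ ⟩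
  pushAll (reduce u′) (reduce v′) ≡⟨ pushAll-reduce u′ (reduce-Reduced v′) ⟨
  pushAll u′ (reduce v′)         ≡⟨ reduce-++ u′ v′ ⟨
  reduce (u′ ++ v′)              ∎
  where open ≡.≡-Reasoning

∷∷-cancel : ∀ x w → (x ∷ x ∷ w) ~ w
∷∷-cancel x w = push-involutive x (reduce-Reduced w)

·-inverseʳ : ∀ u → (u · inv u) ~ []
·-inverseʳ []      = refl
·-inverseʳ (x ∷ u) = begin
  push x (reduce (u ++ reverse (x ∷ u)))          ≡⟨ cong (λ v → push x (reduce (u ++ v))) (unfold-reverse x u) ⟩
  push x (reduce (u ++ (reverse u ++ x ∷ [])))    ≡⟨ cong (λ v → push x (reduce v)) (++-assoc u (reverse u) _) ⟨
  push x (reduce ((u ++ reverse u) ++ x ∷ []))    ≡⟨ cong (push x) (·-cong {u ++ reverse u} {[]} {x ∷ []} {x ∷ []} (·-inverseʳ u) refl) ⟩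
  push x (x ∷ [])                                 ≡⟨ push-cancel x [] ⟩
  []                                              ∎
  where open ≡.≡-Reasoning

·-inverseˡ : ∀ u → (inv u · u) ~ []
·-inverseˡ u = ≡.subst (λ v → (reverse u ++ v) ~ []) (reverse-involutive u) (·-inverseʳ (reverse u))

·-assoc : ∀ u v w → ((u · v) · w) ~ (u · (v · w))
·-assoc u v w = cong reduce (++-assoc u v w)

·-identityʳ : ∀ u → (u · []) ~ u
·-identityʳ u = cong reduce (++-identityʳ u)

inv-cong : ∀ {u v} → u ~ v → inv u ~ inv v
inv-cong {u} {v} u~v = begin
  reduce (reverse u)                       ≡⟨ ·-identityʳ (reverse u) ⟨
  reduce (reverse u ++ [])                 ≡⟨ ·-cong {reverse u} {reverse u} {[]} {v ++ reverse v} refl (≡.sym (·-inverseʳ v)) ⟩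
  reduce (reverse u ++ (v ++ reverse v))   ≡⟨ ·-assoc (reverse u) v (reverse v) ⟨
  reduce ((reverse u ++ v) ++ reverse v)   ≡⟨ ·-cong {reverse u ++ v} {[]} {reverse v} {reverse v} inv-u·v refl ⟩
  reduce (reverse v)                       ∎
  where
  open ≡.≡-Reasoning
  inv-u·v : (inv u · v) ~ []
  inv-u·v = ≡.trans (·-cong {reverse u} {reverse u} {v} {u} refl (≡.sym u~v)) (·-inverseˡ u)

-- Wrapping _~_ in a record lets Agda infer the words compared, which reduce u ≡ reduce v does not.
record _≈Δ_ (u v : Word) : Set where
  constructor mk≈Δ
  field reduce-≡ : u ~ v

Δ : Group 0ℓ 0ℓ
Δ = record
  { Carrier = Word
  ; _≈_     = _≈Δ_
  ; _∙_     = _·_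
  ; ε       = []
  ; _⁻¹     = inv
  ; isGroup = record
    { isMonoid = record
      { isSemigroup = record
        { isMagma = record
          { isEquivalence = record
            { refl  = mk≈Δ refl
            ; sym   = λ (mk≈Δ p) → mk≈Δ (≡.sym p)
            ; trans = λ (mk≈Δ p) (mk≈Δ q) → mk≈Δ (≡.trans p q)
            }
          ; ∙-cong = λ {u} {u′} {v} {v′} (mk≈Δ p) (mk≈Δ q) → mk≈Δ (·-cong {u} {u′} {v} {v′} p q)
          }
        ; assoc = λ u v w → mk≈Δ (·-assoc u v w)
        }
      ; identity = (λ _ → mk≈Δ refl) , (λ u → mk≈Δ (·-identityʳ u))
      }
    ; inverse = (λ u → mk≈Δ (·-inverseˡ u)) , (λ u → mk≈Δ (·-inverseʳ u))
    ; ⁻¹-cong = λ {u} {v} (mk≈Δ p) → mk≈Δ (inv-cong {u} {v} p)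
    }
  }

InΔ⁺-++ : ∀ {u v} → InΔ⁺ u → InΔ⁺ v → InΔ⁺ (u ++ v)
InΔ⁺-++ {u} {v} u⁺ v⁺ = begin
  length (u ++ v) % 2                  ≡⟨ cong (_% 2) (length-++ u) ⟩
  (length u + length v) % 2            ≡⟨ %-distribˡ-+ (length u) (length v) 2 ⟩
  (length u % 2 + length v % 2) % 2    ≡⟨ cong₂ (λ m n → (m + n) % 2) u⁺ v⁺ ⟩
  0                                    ∎
  where open ≡.≡-Reasoning

InΔ⁺-reverse : ∀ {u} → InΔ⁺ u → InΔ⁺ (reverse u)
InΔ⁺-reverse {u} = ≡.trans (cong (_% 2) (length-reverse u))

InΔ⁺-mirror : ∀ {w} → InΔ⁺ w → InΔ⁺ (r₂ · (w · r₂))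
InΔ⁺-mirror {w} = ≡.trans (cong (λ n → suc n % 2) (≡.trans (length-++ w) (+-comm (length w) 1)))

Δ⁺-Carrier : Set
Δ⁺-Carrier = Σ Word InΔ⁺

record _≈Δ⁺_ (x y : Δ⁺-Carrier) : Set where
  constructor mk≈Δ⁺
  field word-≈ : proj₁ x ≈Δ proj₁ y

Δ⁺-rawGroup : RawGroup 0ℓ 0ℓ
Δ⁺-rawGroup = record
  { Carrier = Δ⁺-Carrier
  ; _≈_     = _≈Δ⁺_
  ; _∙_     = λ (u , u⁺) (v , v⁺) → u · v , InΔ⁺-++ {u} {v} u⁺ v⁺
  ; ε       = [] , refl
  ; _⁻¹     = λ (u , u⁺) → inv u , InΔ⁺-reverse {u} u⁺
  }

proj₁-isGroupMonomorphism : IsGroupMonomorphism Δ⁺-rawGroup (Group.rawGroup Δ) proj₁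
proj₁-isGroupMonomorphism = record
  { isGroupHomomorphism = record
    { isMonoidHomomorphism = record
      { isMagmaHomomorphism = record
        { isRelHomomorphism = record { cong = _≈Δ⁺_.word-≈ }
        ; homo              = λ _ _ → Group.refl Δ
        }
      ; ε-homo = Group.refl Δ
      }
    ; ⁻¹-homo = λ _ → Group.refl Δ
    }
  ; injective = mk≈Δ⁺
  }

Δ⁺ : Group 0ℓ 0ℓ
Δ⁺ = record
  { RawGroup Δ⁺-rawGroup
  ; isGroup = GroupMonomorphism.isGroup proj₁-isGroupMonomorphism (Group.isGroup Δ)
  }

-- Conjugation and normal subgroups

module _ {a b ℓ₁ ℓ₂} (G : Group a ℓ₁) (G′ : Group b ℓ₂) where
  private
    module G = Group G
    module G′ = Group G′
  open Group G′
  open GroupProperties G′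
  open SetoidReasoning setoid

  magmaHomomorphism⇒groupHomomorphism : ∀ {f} → IsMagmaHomomorphism G.rawMagma G′.rawMagma f →
                                        IsGroupHomomorphism G.rawGroup G′.rawGroup f
  magmaHomomorphism⇒groupHomomorphism {f} f-homo = record
    { isMonoidHomomorphism = record { isMagmaHomomorphism = f-homo ; ε-homo = ε-homo }
    ; ⁻¹-homo = λ x → inverseˡ-unique (f (x G.⁻¹)) (f x) (begin
        f (x G.⁻¹) ∙ f x   ≈⟨ homo (x G.⁻¹) x ⟨
        f (x G.⁻¹ G.∙ x)   ≈⟨ ⟦⟧-cong (G.inverseˡ x) ⟩
        f G.ε              ≈⟨ ε-homo ⟩
        ε                  ∎)
    }
    where
    open IsMagmaHomomorphism f-homo
    ε-homo : f G.ε ≈ ε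
    ε-homo = identityˡ-unique (f G.ε) (f G.ε) (trans (sym (homo G.ε G.ε)) (⟦⟧-cong (G.identityˡ G.ε)))

module Conjugation {a ℓ} (G : Group a ℓ) where
  open Group G
  open GroupProperties G
  open SetoidReasoning setoid

  conj : Carrier → Carrier → Carrier
  conj g x = g ∙ (x ∙ g ⁻¹)

  conj-cong : ∀ g {x y} → x ≈ y → conj g x ≈ conj g y
  conj-cong g x≈y = ∙-congˡ (∙-congʳ x≈y)

  conj-congˡ : ∀ {g h} x → g ≈ h → conj g x ≈ conj h x
  conj-congˡ x g≈h = ∙-cong g≈h (∙-congˡ (⁻¹-cong g≈h))

  conj-homo : ∀ g x y → conj g (x ∙ y) ≈ conj g x ∙ conj g y
  conj-homo g x y = begin
    g ∙ (x ∙ y ∙ g ⁻¹)                   ≈⟨ ∙-congˡ (assoc x y (g ⁻¹)) ⟩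
    g ∙ (x ∙ (y ∙ g ⁻¹))                 ≈⟨ ∙-congˡ (∙-congˡ (\\-leftDividesʳ g _)) ⟨
    g ∙ (x ∙ (g ⁻¹ ∙ (g ∙ (y ∙ g ⁻¹))))  ≈⟨ ∙-congˡ (assoc x (g ⁻¹) _) ⟨
    g ∙ (x ∙ g ⁻¹ ∙ conj g y)            ≈⟨ assoc g (x ∙ g ⁻¹) _ ⟨
    conj g x ∙ conj g y                  ∎

  conj-isGroupHomomorphism : ∀ g → IsGroupHomomorphism rawGroup rawGroup (conj g)
  conj-isGroupHomomorphism g = magmaHomomorphism⇒groupHomomorphism G G record
    { isRelHomomorphism = record { cong = conj-cong g }
    ; homo              = conj-homo g
    }

  conj-⁻¹ : ∀ g x → conj g (x ⁻¹) ≈ conj g x ⁻¹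
  conj-⁻¹ g = IsGroupHomomorphism.⁻¹-homo (conj-isGroupHomomorphism g)

  conj-identity : ∀ x → conj ε x ≈ x
  conj-identity x = trans (identityˡ _) (trans (∙-congˡ ε⁻¹≈ε) (identityʳ x))

  conj-∙ : ∀ g h x → conj (g ∙ h) x ≈ conj g (conj h x)
  conj-∙ g h x = begin
    g ∙ h ∙ (x ∙ (g ∙ h) ⁻¹)          ≈⟨ ∙-congˡ (∙-congˡ (⁻¹-anti-homo-∙ g h)) ⟩
    g ∙ h ∙ (x ∙ (h ⁻¹ ∙ g ⁻¹))       ≈⟨ assoc g h _ ⟩
    g ∙ (h ∙ (x ∙ (h ⁻¹ ∙ g ⁻¹)))     ≈⟨ ∙-congˡ (∙-congˡ (assoc x (h ⁻¹) (g ⁻¹))) ⟨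
    g ∙ (h ∙ (x ∙ h ⁻¹ ∙ g ⁻¹))       ≈⟨ ∙-congˡ (assoc h _ _) ⟨
    g ∙ (conj h x ∙ g ⁻¹)             ∎

  conj-inverseˡ : ∀ g x → conj (g ⁻¹) (conj g x) ≈ x
  conj-inverseˡ g x = begin
    conj (g ⁻¹) (conj g x)  ≈⟨ conj-∙ (g ⁻¹) g x ⟨
    conj (g ⁻¹ ∙ g) x       ≈⟨ conj-congˡ x (inverseˡ g) ⟩
    conj ε x                ≈⟨ conj-identity x ⟩
    x                       ∎

  conj-inverseʳ : ∀ g x → conj g (conj (g ⁻¹) x) ≈ x
  conj-inverseʳ g x = trans (conj-congˡ _ (sym (⁻¹-involutive g))) (conj-inverseˡ (g ⁻¹) x)

  conj∙⁻¹≈∙conj⁻¹ : ∀ g x → conj g x ∙ x ⁻¹ ≈ g ∙ conj x (g ⁻¹)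
  conj∙⁻¹≈∙conj⁻¹ g x = trans (assoc g _ _) (∙-congˡ (assoc x (g ⁻¹) (x ⁻¹)))

  conj-injective : TrivialCentre G → ∀ {g h} → (∀ x → conj g x ≈ conj h x) → g ≈ h
  conj-injective trivialCentre {g} {h} conj≈ = begin
    g                ≈⟨ \\-leftDividesˡ h g ⟨
    h ∙ (h ⁻¹ ∙ g)   ≈⟨ ∙-congˡ (trivialCentre (h ⁻¹ ∙ g) central) ⟩
    h ∙ ε            ≈⟨ identityʳ h ⟩
    h                ∎
    where
    central : ∀ x → h ⁻¹ ∙ g ∙ x ≈ x ∙ (h ⁻¹ ∙ g)
    central x = begin
      h ⁻¹ ∙ g ∙ x                              ≈⟨ //-rightDividesˡ (h ⁻¹ ∙ g) _ ⟨
      (h ⁻¹ ∙ g ∙ x) ∙ (h ⁻¹ ∙ g) ⁻¹ ∙ (h ⁻¹ ∙ g)  ≈⟨ ∙-congʳ (assoc _ x _) ⟩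
      conj (h ⁻¹ ∙ g) x ∙ (h ⁻¹ ∙ g)            ≈⟨ ∙-congʳ (conj-∙ (h ⁻¹) g x) ⟩
      conj (h ⁻¹) (conj g x) ∙ (h ⁻¹ ∙ g)       ≈⟨ ∙-congʳ (conj-cong (h ⁻¹) (conj≈ x)) ⟩
      conj (h ⁻¹) (conj h x) ∙ (h ⁻¹ ∙ g)       ≈⟨ ∙-congʳ (conj-inverseˡ h x) ⟩
      x ∙ (h ⁻¹ ∙ g)                            ∎

module _ {a ℓ} (G : Group a ℓ) where
  open Group G
  open Conjugation G

  record IsNormalSubgroup {p} (N : Carrier → Set p) : Set (a ⊔ ℓ ⊔ p) where
    field
      respects    : ∀ {x y} → x ≈ y → N x → N y
      ε-closed    : N ε
      ∙-closed    : ∀ {x y} → N x → N y → N (x ∙ y)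
      ⁻¹-closed   : ∀ {x} → N x → N (x ⁻¹)
      conj-closed : ∀ g {x} → N x → N (conj g x)

  ∩-isNormalSubgroup : ∀ {p q} {M : Carrier → Set p} {N : Carrier → Set q} →
                       IsNormalSubgroup M → IsNormalSubgroup N → IsNormalSubgroup (λ x → M x × N x)
  ∩-isNormalSubgroup M-normal N-normal = record
    { respects    = λ x≈y → Product.map (M.respects x≈y) (N.respects x≈y)
    ; ε-closed    = M.ε-closed , N.ε-closed
    ; ∙-closed    = Product.zip M.∙-closed N.∙-closed
    ; ⁻¹-closed   = Product.map M.⁻¹-closed N.⁻¹-closed
    ; conj-closed = λ g → Product.map (M.conj-closed g) (N.conj-closed g)
    }
    where
    module M = IsNormalSubgroup M-normal
    module N = IsNormalSubgroup N-normal

module _ {a b ℓ₁ ℓ₂} (G : Group a ℓ₁) (G′ : Group b ℓ₂) where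
  private
    module G = Group G
    module GC = Conjugation G
  open Group G′
  open Conjugation G′

  homo-conj : ∀ {f} → IsGroupHomomorphism G.rawGroup rawGroup f → ∀ g x → f (GC.conj g x) ≈ conj (f g) (f x)
  homo-conj f-homo g x = trans (homo g _) (∙-congˡ (trans (homo x _) (∙-congˡ (⁻¹-homo g))))
    where open IsGroupHomomorphism f-homo

  preimage-isNormalSubgroup : ∀ {p} {N : Carrier → Set p} {f : G.Carrier → Carrier} →
                              IsGroupHomomorphism G.rawGroup rawGroup f →
                              IsNormalSubgroup G′ N → IsNormalSubgroup G (λ x → N (f x))
  preimage-isNormalSubgroup f-homo N-normal = record
    { respects    = λ x≈y → N.respects (⟦⟧-cong x≈y)
    ; ε-closed    = N.respects (sym ε-homo) N.ε-closed
    ; ∙-closed    = λ Nfx Nfy → N.respects (sym (homo _ _)) (N.∙-closed Nfx Nfy)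
    ; ⁻¹-closed   = λ Nfx → N.respects (sym (⁻¹-homo _)) (N.⁻¹-closed Nfx)
    ; conj-closed = λ g Nfx → N.respects (sym (homo-conj f-homo g _)) (N.conj-closed _ Nfx)
    }
    where
    module N = IsNormalSubgroup N-normal
    open IsGroupHomomorphism f-homo

-- Extending a quotient map onto a complete group

module _ {a ℓ c ℓ′} (G : Group a ℓ) (S : Group c ℓ′) where
  private
    module G = Group G
    module S = Group S

  module CompleteQuotientExtension
    (S-complete : IsComplete S)
    {p q} {H : G.Carrier → Set p} {K : G.Carrier → Set q}
    (H-normal : IsNormalSubgroup G H) (K-normal : IsNormalSubgroup G K)
    (φ : ∀ x → H x → S.Carrier)
    (φ-homo : ∀ x y (hx : H x) (hy : H y) →
              φ (x G.∙ y) (IsNormalSubgroup.∙-closed H-normal hx hy) S.≈ φ x hx S.∙ φ y hy)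
    (φ-kernel : ∀ x y (hx : H x) (hy : H y) →
                (φ x hx S.≈ φ y hy → K (x G.∙ y G.⁻¹)) × (K (x G.∙ y G.⁻¹) → φ x hx S.≈ φ y hy))
    (φ-surjective : ∀ s → Σ G.Carrier λ x → Σ (H x) λ hx → φ x hx S.≈ s)
    where

    private
      module H = IsNormalSubgroup H-normal
      module K = IsNormalSubgroup K-normal
      module GP = GroupProperties G
      module GC = Conjugation G
    open Group S
    open GroupProperties S
    open Conjugation S
    open SetoidReasoning setoid

    φ-cong : ∀ {x y} (hx : H x) (hy : H y) → x G.≈ y → φ x hx ≈ φ y hy
    φ-cong hx hy x≈y = proj₂ (φ-kernel _ _ hx hy) (K.respects (G.sym (GP.x≈y⇒x∙y⁻¹≈ε x≈y)) K.ε-closed)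

    φ-homo′ : ∀ {x y} (hxy : H (x G.∙ y)) (hx : H x) (hy : H y) → φ (x G.∙ y) hxy ≈ φ x hx ∙ φ y hy
    φ-homo′ hxy hx hy = trans (φ-cong hxy (H.∙-closed hx hy) G.refl) (φ-homo _ _ hx hy)

    φ-ε : φ G.ε H.ε-closed ≈ ε
    φ-ε = identityˡ-unique _ _ (trans (sym (φ-homo _ _ H.ε-closed H.ε-closed)) (φ-cong _ _ (G.identityˡ G.ε)))

    φ-⁻¹ : ∀ {x} (hx : H x) → φ (x G.⁻¹) (H.⁻¹-closed hx) ≈ φ x hx ⁻¹
    φ-⁻¹ {x} hx = inverseˡ-unique _ _ (begin
      φ (x G.⁻¹) _ ∙ φ x hx   ≈⟨ φ-homo _ _ _ hx ⟨
      φ (x G.⁻¹ G.∙ x) _      ≈⟨ φ-cong _ H.ε-closed (G.inverseˡ x) ⟩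
      φ G.ε H.ε-closed        ≈⟨ φ-ε ⟩
      ε                       ∎)

    φ-conj : ∀ g {x y} (hx : H x) (hy : H y) → φ x hx ≈ φ y hy →
             φ (GC.conj g x) (H.conj-closed g hx) ≈ φ (GC.conj g y) (H.conj-closed g hy)
    φ-conj g {x} {y} hx hy φx≈φy = proj₂ (φ-kernel _ _ _ _)
      (K.respects conj-quotient (K.conj-closed g (proj₁ (φ-kernel _ _ hx hy) φx≈φy)))
      where
      conj-quotient : GC.conj g (x G.∙ y G.⁻¹) G.≈ GC.conj g x G.∙ GC.conj g y G.⁻¹
      conj-quotient = G.trans (GC.conj-homo g x _) (G.∙-congˡ (GC.conj-⁻¹ g y))

    private
      preimage : Carrier → G.Carrier
      preimage s = proj₁ (φ-surjective s)

      preimage-H : ∀ s → H (preimage s)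
      preimage-H s = proj₁ (proj₂ (φ-surjective s))

      φ-preimage : ∀ s → φ (preimage s) (preimage-H s) ≈ s
      φ-preimage s = proj₂ (proj₂ (φ-surjective s))

    induced : G.Carrier → Carrier → Carrier
    induced g s = φ (GC.conj g (preimage s)) (H.conj-closed g (preimage-H s))

    induced-φ : ∀ g {x} (hx : H x) → induced g (φ x hx) ≈ φ (GC.conj g x) (H.conj-closed g hx)
    induced-φ g hx = φ-conj g _ hx (φ-preimage _)

    module _ (g : G.Carrier) where

      induced-cong : ∀ {s t} → s ≈ t → induced g s ≈ induced g t
      induced-cong s≈t = φ-conj g _ _ (trans (φ-preimage _) (trans s≈t (sym (φ-preimage _))))

      induced-homo : ∀ s t → induced g (s ∙ t) ≈ induced g s ∙ induced g t
      induced-homo s t = begin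
        induced g (s ∙ t)                        ≈⟨ induced-cong (trans (φ-homo _ _ _ _) (∙-cong (φ-preimage s) (φ-preimage t))) ⟨
        induced g (φ (u G.∙ v) (H.∙-closed _ _))  ≈⟨ induced-φ g _ ⟩
        φ (GC.conj g (u G.∙ v)) _                ≈⟨ φ-cong _ (H.∙-closed _ _) (GC.conj-homo g u v) ⟩
        φ (GC.conj g u G.∙ GC.conj g v) _        ≈⟨ φ-homo _ _ _ _ ⟩
        induced g s ∙ induced g t                ∎
        where
        u = preimage s
        v = preimage t

      induced-injective : ∀ {s t} → induced g s ≈ induced g t → s ≈ t
      induced-injective {s} {t} eq = begin
        s                                                  ≈⟨ φ-preimage s ⟨
        φ (preimage s) _                                   ≈⟨ φ-cong _ _ (G.sym (GC.conj-inverseˡ g _)) ⟩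
        φ (GC.conj (g G.⁻¹) (GC.conj g (preimage s))) _    ≈⟨ φ-conj (g G.⁻¹) _ _ eq ⟩
        φ (GC.conj (g G.⁻¹) (GC.conj g (preimage t))) _    ≈⟨ φ-cong _ _ (GC.conj-inverseˡ g _) ⟩
        φ (preimage t) _                                   ≈⟨ φ-preimage t ⟩
        t                                                  ∎

      induced-strictlySurjective : StrictlySurjective _≈_ (induced g)
      induced-strictlySurjective s = φ (GC.conj (g G.⁻¹) (preimage s)) (H.conj-closed _ (preimage-H s)) , (begin
        induced g (φ (GC.conj (g G.⁻¹) (preimage s)) _)   ≈⟨ induced-φ g _ ⟩
        φ (GC.conj g (GC.conj (g G.⁻¹) (preimage s))) _   ≈⟨ φ-cong _ _ (GC.conj-inverseʳ g _) ⟩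
        φ (preimage s) _                                  ≈⟨ φ-preimage s ⟩
        s                                                 ∎)

      induced-isGroupIsomorphism : IsGroupIsomorphism rawGroup rawGroup (induced g)
      induced-isGroupIsomorphism = record
        { isGroupMonomorphism = record
          { isGroupHomomorphism = magmaHomomorphism⇒groupHomomorphism S S record
            { isRelHomomorphism = record { cong = induced-cong }
            ; homo              = induced-homo
            }
          ; injective = induced-injective
          }
        ; surjective = strictlySurjective⇒surjective trans induced-cong induced-strictlySurjective
        }

    -- Everything about extension follows from induced≈conj-extension, and unfolding it is very costly.
    opaque
      extension : G.Carrier → Carrier
      extension g = proj₁ (proj₂ S-complete (induced g) (induced-isGroupIsomorphism g))

      induced≈conj-extension : ∀ g s → induced g s ≈ conj (extension g) s
      induced≈conj-extension g s =
        trans (proj₂ (proj₂ S-complete (induced g) (induced-isGroupIsomorphism g)) s) (assoc _ s _)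

    conj-extension-injective : ∀ {t u} → (∀ s → conj t s ≈ conj u s) → t ≈ u
    conj-extension-injective = conj-injective (proj₁ S-complete)

    extension-isGroupHomomorphism : IsGroupHomomorphism G.rawGroup rawGroup extension
    extension-isGroupHomomorphism = magmaHomomorphism⇒groupHomomorphism G S record
      { isRelHomomorphism = record { cong = extension-cong }
      ; homo              = extension-homo
      }
      where
      extension-cong : ∀ {g h} → g G.≈ h → extension g ≈ extension h
      extension-cong {g} {h} g≈h = conj-extension-injective λ s → begin
        conj (extension g) s  ≈⟨ induced≈conj-extension g s ⟨
        induced g s           ≈⟨ φ-cong _ _ (GC.conj-congˡ (preimage s) g≈h) ⟩
        induced h s           ≈⟨ induced≈conj-extension h s ⟩
        conj (extension h) s  ∎

      extension-homo : ∀ g h → extension (g G.∙ h) ≈ extension g ∙ extension h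
      extension-homo g h = conj-extension-injective λ s → begin
        conj (extension (g G.∙ h)) s                         ≈⟨ induced≈conj-extension (g G.∙ h) s ⟨
        φ (GC.conj (g G.∙ h) (preimage s)) _                 ≈⟨ φ-cong _ (H.conj-closed g (H.conj-closed h _)) (GC.conj-∙ g h _) ⟩
        φ (GC.conj g (GC.conj h (preimage s))) _             ≈⟨ induced-φ g _ ⟨
        induced g (induced h s)                              ≈⟨ induced-cong g (induced≈conj-extension h s) ⟩
        induced g (conj (extension h) s)                     ≈⟨ induced≈conj-extension g _ ⟩
        conj (extension g) (conj (extension h) s)            ≈⟨ conj-∙ _ _ s ⟨
        conj (extension g ∙ extension h) s                   ∎

    extension-φ : ∀ {x} (hx : H x) → extension x ≈ φ x hx
    extension-φ {x} hx = conj-extension-injective λ s → begin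
      conj (extension x) s                                   ≈⟨ induced≈conj-extension x s ⟨
      φ (x G.∙ (preimage s G.∙ x G.⁻¹)) _                    ≈⟨ φ-homo′ _ hx (H.∙-closed (preimage-H s) (H.⁻¹-closed hx)) ⟩
      φ x hx ∙ φ (preimage s G.∙ x G.⁻¹) _                   ≈⟨ ∙-congˡ (φ-homo _ _ _ _) ⟩
      φ x hx ∙ (φ (preimage s) _ ∙ φ (x G.⁻¹) _)             ≈⟨ ∙-congˡ (∙-cong (φ-preimage s) (φ-⁻¹ hx)) ⟩
      conj (φ x hx) s                                        ∎

    extension-trivial : ∀ {r} {N : G.Carrier → Set r} → IsNormalSubgroup G N →
                        (∀ {x} → H x → N x → K x) → ∀ {g} → N g → extension g ≈ ε
    extension-trivial {N = N} N-normal H∩N⊆K {g} ng = conj-extension-injective λ s → begin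
      conj (extension g) s  ≈⟨ induced≈conj-extension g s ⟨
      induced g s           ≈⟨ induced-trivial s ⟩
      s                     ≈⟨ conj-identity s ⟨
      conj ε s              ∎
      where
      module N = IsNormalSubgroup N-normal

      induced-trivial : ∀ s → induced g s ≈ s
      induced-trivial s = trans (proj₂ (φ-kernel _ _ _ _) (H∩N⊆K H-commutator N-commutator)) (φ-preimage s)
        where
        u = preimage s
        H-commutator : H (GC.conj g u G.∙ u G.⁻¹)
        H-commutator = H.∙-closed (H.conj-closed g (preimage-H s)) (H.⁻¹-closed (preimage-H s))
        N-commutator : N (GC.conj g u G.∙ u G.⁻¹)
        N-commutator = N.respects (G.sym (GC.conj∙⁻¹≈∙conj⁻¹ g u)) (N.∙-closed ng (N.conj-closed u (N.⁻¹-closed ng)))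

-- Conjugation by r₂ on Δ⁺

mirror : Δ⁺-Carrier → Δ⁺-Carrier
mirror (w , w⁺) = r₂ · (w · r₂) , InΔ⁺-mirror {w} w⁺

mirror-isGroupHomomorphism : IsGroupHomomorphism (Group.rawGroup Δ⁺) (Group.rawGroup Δ⁺) mirror
mirror-isGroupHomomorphism = magmaHomomorphism⇒groupHomomorphism Δ⁺ Δ⁺ record
  { isRelHomomorphism = record { cong = λ (mk≈Δ⁺ u≈v) → mk≈Δ⁺ (Conjugation.conj-cong Δ r₂ u≈v) }
  ; homo              = λ (u , _) (v , _) → mk≈Δ⁺ (Conjugation.conj-homo Δ r₂ u v)
  }

mirror-involutive : ∀ x → mirror (mirror x) ≈Δ⁺ x
mirror-involutive (w , _) = mk≈Δ⁺ (Conjugation.conj-inverseˡ Δ r₂ w)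

module _ {a ℓ} (A : AbelianGroup a ℓ) {ψ : Δ⁺-Carrier → AbelianGroup.Carrier A}
         (ψ-homo : IsGroupHomomorphism (Group.rawGroup Δ⁺) (AbelianGroup.rawGroup A) ψ) where
  open AbelianGroup A
  open GroupProperties group using (ε⁻¹≈ε)
  open AbelianGroupProperties A using (⁻¹-∙-comm)
  open IsGroupHomomorphism ψ-homo
  open SetoidReasoning setoid
  private
    module Δ⁺ = Group Δ⁺

  -- a b w = (a r₂)(r₂ b) w and r₂ (a b w) r₂ = (r₂ a)(b r₂)(r₂ w r₂), where r₂ a = (a r₂)⁻¹ and b r₂ = (r₂ b)⁻¹.
  homo-mirror≈homo⁻¹ : ∀ x → ψ (mirror x) ≈ ψ x ⁻¹
  homo-mirror≈homo⁻¹ (w , w⁺) = on-words w w⁺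
    where
    t : Fin 3
    t = suc (suc zero)

    pair : Fin 3 → Fin 3 → Δ⁺-Carrier
    pair x y = x ∷ y ∷ [] , ≡.refl

    ψ-pair-swap : ∀ x y → ψ (pair y x) ≈ ψ (pair x y) ⁻¹
    ψ-pair-swap x y = ⁻¹-homo (pair x y)

    ψ-∙∙ : ∀ x y z → ψ (x Δ⁺.∙ (y Δ⁺.∙ z)) ≈ ψ x ∙ (ψ y ∙ ψ z)
    ψ-∙∙ x y z = trans (homo x _) (∙-congˡ (homo y z))

    on-words : ∀ w (w⁺ : InΔ⁺ w) → ψ (mirror (w , w⁺)) ≈ ψ (w , w⁺) ⁻¹
    on-words [] w⁺ = begin
      ψ (mirror ([] , w⁺))  ≈⟨ ⟦⟧-cong (mk≈Δ⁺ (mk≈Δ (∷∷-cancel t []))) ⟩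
      ψ ([] , w⁺)           ≈⟨ ψ-[] ⟩
      ε                     ≈⟨ ε⁻¹≈ε ⟨
      ε ⁻¹                  ≈⟨ ⁻¹-cong ψ-[] ⟨
      ψ ([] , w⁺) ⁻¹        ∎
      where
      ψ-[] : ψ ([] , w⁺) ≈ ε
      ψ-[] = trans (⟦⟧-cong (mk≈Δ⁺ (mk≈Δ ≡.refl))) ε-homo
    on-words (a ∷ b ∷ w) w⁺ = begin
      ψ (mirror (a ∷ b ∷ w , w⁺))
        ≈⟨ ⟦⟧-cong (mk≈Δ⁺ (mk≈Δ (cong (λ r → push t (push a (push b r))) (≡.sym (∷∷-cancel t (w · r₂)))))) ⟩
      ψ (pair t a Δ⁺.∙ (pair b t Δ⁺.∙ mirror (w , w⁺)))
        ≈⟨ ψ-∙∙ (pair t a) (pair b t) (mirror (w , w⁺)) ⟩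
      ψ (pair t a) ∙ (ψ (pair b t) ∙ ψ (mirror (w , w⁺)))
        ≈⟨ ∙-cong (ψ-pair-swap a t) (∙-cong (ψ-pair-swap t b) (on-words w w⁺)) ⟩
      ψ (pair a t) ⁻¹ ∙ (ψ (pair t b) ⁻¹ ∙ ψ (w , w⁺) ⁻¹)
        ≈⟨ trans (∙-congˡ (⁻¹-∙-comm _ _)) (⁻¹-∙-comm _ _) ⟩
      (ψ (pair a t) ∙ (ψ (pair t b) ∙ ψ (w , w⁺))) ⁻¹
        ≈⟨ ⁻¹-cong (ψ-∙∙ (pair a t) (pair t b) (w , w⁺)) ⟨
      ψ (pair a t Δ⁺.∙ (pair t b Δ⁺.∙ (w , w⁺))) ⁻¹
        ≈⟨ ⁻¹-cong (⟦⟧-cong (mk≈Δ⁺ (mk≈Δ (cong (push a) (∷∷-cancel t (b ∷ w)))))) ⟩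
      ψ (a ∷ b ∷ w , w⁺) ⁻¹
        ∎

-- Chirality groups

module ChiralityGroup {c ℓ} (S : Group c ℓ) (𝓗 : HypermapSubgroup) (S≅H/K : IsoToChiralityGroup S 𝓗) where
  open HypermapSubgroup 𝓗
  open Group S using (Carrier; rawGroup; ε)
  private
    module S = Group S
    module Δ⁺ = Group Δ⁺

  H⁺ : Δ⁺-Carrier → Set
  H⁺ (w , _) = H w

  H⁺-normal : IsNormalSubgroup Δ⁺ H⁺
  H⁺-normal = record
    { respects    = λ (mk≈Δ⁺ (mk≈Δ u~v)) → respects u~v
    ; ε-closed    = has-ε
    ; ∙-closed    = ·-closed
    ; ⁻¹-closed   = inv-closed
    ; conj-closed = λ (g , g⁺) → normal {g} g⁺
    }

  -- Hʳ⁺ (w , _) unfolds to Hʳ w, so H⁺ ∩ Hʳ⁺ is literally the kernel in IsoToChiralityGroup.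
  Hʳ⁺ : Δ⁺-Carrier → Set
  Hʳ⁺ x = H⁺ (mirror x)

  Hʳ⁺-normal : IsNormalSubgroup Δ⁺ Hʳ⁺
  Hʳ⁺-normal = preimage-isNormalSubgroup Δ⁺ Δ⁺ mirror-isGroupHomomorphism H⁺-normal

  φ : ∀ x → H⁺ x → Carrier
  φ (w , _) = proj₁ S≅H/K w

  φ-homo : ∀ x y (hx : H⁺ x) (hy : H⁺ y) → φ (x Δ⁺.∙ y) (·-closed hx hy) S.≈ φ x hx S.∙ φ y hy
  φ-homo _ _ hx hy = proj₁ (proj₂ S≅H/K) _ _ hx hy

  φ-kernel : ∀ x y (hx : H⁺ x) (hy : H⁺ y) →
             (φ x hx S.≈ φ y hy → H⁺ (x Δ⁺.∙ y Δ⁺.⁻¹) × Hʳ⁺ (x Δ⁺.∙ y Δ⁺.⁻¹)) ×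
             (H⁺ (x Δ⁺.∙ y Δ⁺.⁻¹) × Hʳ⁺ (x Δ⁺.∙ y Δ⁺.⁻¹) → φ x hx S.≈ φ y hy)
  φ-kernel _ _ hx hy = proj₁ (proj₂ (proj₂ S≅H/K)) _ _ hx hy

  φ-surjective : ∀ s → Σ Δ⁺-Carrier λ x → Σ (H⁺ x) λ hx → φ x hx S.≈ s
  φ-surjective s with proj₂ (proj₂ (proj₂ S≅H/K)) s
  ... | w , hw , φw≈s = (w , ⊆Δ⁺ hw) , hw , φw≈s

  module _ (S-complete : IsComplete S) where
    open CompleteQuotientExtension Δ⁺ S S-complete H⁺-normal (∩-isNormalSubgroup Δ⁺ H⁺-normal Hʳ⁺-normal)
      φ φ-homo φ-kernel φ-surjective

    module _ {a ℓ′} (A : AbelianGroup a ℓ′) {f : Carrier → AbelianGroup.Carrier A}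
             (f-homo : IsGroupHomomorphism rawGroup (AbelianGroup.rawGroup A) f) where
      private
        module A = AbelianGroup A
        module F = IsGroupHomomorphism f-homo
      open SetoidReasoning A.setoid
      open GroupProperties A.group using (ε⁻¹≈ε)

      homo∘extension≈ε : ∀ {x} → H⁺ x → f (extension x) A.≈ A.ε
      homo∘extension≈ε {x} hx = begin
        f (extension x)                        ≈⟨ ψ.⟦⟧-cong (mirror-involutive x) ⟨
        f (extension (mirror (mirror x)))      ≈⟨ homo-mirror≈homo⁻¹ A ψ-homo (mirror x) ⟩
        f (extension (mirror x)) A.⁻¹          ≈⟨ A.⁻¹-cong (F.⟦⟧-cong (extension-trivial Hʳ⁺-normal _,_ {mirror x} hʳ)) ⟩
        f ε A.⁻¹                               ≈⟨ A.⁻¹-cong F.ε-homo ⟩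
        A.ε A.⁻¹                               ≈⟨ ε⁻¹≈ε ⟩
        A.ε                                    ∎
        where
        ψ-homo : IsGroupHomomorphism Δ⁺.rawGroup A.rawGroup (λ x → f (extension x))
        ψ-homo = Composition.isGroupHomomorphism A.trans extension-isGroupHomomorphism f-homo
        module ψ = IsGroupHomomorphism ψ-homo
        hʳ : Hʳ⁺ (mirror x)
        hʳ = IsNormalSubgroup.respects H⁺-normal (Δ⁺.sym (mirror-involutive x)) hx

      homo≈ε : ∀ s → f s A.≈ A.ε
      homo≈ε s with φ-surjective s
      ... | x , hx , φx≈s = begin
        f s                ≈⟨ F.⟦⟧-cong φx≈s ⟨
        f (φ x hx)         ≈⟨ F.⟦⟧-cong (extension-φ hx) ⟨
        f (extension x)    ≈⟨ homo∘extension≈ε hx ⟩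
        A.ε                ∎

    complete⇒perfect : IsPerfect S
    complete⇒perfect A f f-homo f-surjective a =
      A.trans (A.sym (proj₂ (f-surjective a) S.refl)) (homo≈ε A f-homo _)
      where module A = AbelianGroup A

corollary22 : {c ℓ : Level} (S : Group c ℓ) →
    IsComplete S → ¬ IsPerfect S → ¬ IsChiralityGroup S
corollary22 S S-complete S-not-perfect (𝓗 , S≅H/K) =
  S-not-perfect (ChiralityGroup.complete⇒perfect S 𝓗 S≅H/K S-complete)
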